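{- Let $p>2$ be a prime. (1) Let $\mathcal{A}\le M(m,n,\mathbb{F}_p)$ be a matrix space and $\Lambda\subseteq\Lambda'$ attribute sets in $\mathbb{F}_p^n$. Then $\ker(\mathcal{A},\Lambda)$ is a subspace of $\ker(\mathcal{A},\Lambda')$. (2) Let $\mathcal{B}\le\mathrm{SS}(n,\mathbb{F}_p)$ be a skew-symmetric matrix space and $\Delta\subseteq\Delta'$ attribute sets in $\mathbb{F}_p^n$. Then $\dim\ker_{\mathrm{skew}}(\mathcal{B},\Delta')\ge\dim\ker_{\mathrm{skew}}(\mathcal{B},\Delta)-|\Delta'|+|\Delta|$.
   Context: Vectors are row vectors; $\mathrm{SS}(n,\mathbb{F}_p)$ is the space of $n\times n$ skew-symmetric matrices. An attribute set is a set of linearly independent row vectors in $\mathbb{F}_p^n$. For $\mathcal{A}\le M(m,n,\mathbb{F}_p)$, $\ker(\mathcal{A},\Lambda)$ is the span of all $v\in\mathbb{F}_p^m$ with $\langle vA:A\in\mathcal{A}\rangle\subseteq\langle\Lambda\rangle$. For $\mathcal{B}\le\mathrm{SS}(n,\mathbb{F}_p)$, $\ker_{\mathrm{skew}}(\mathcal{B},\Delta)$ is the span of all $v\in\mathbb{F}_p^n$ such that $xv^T=0$ for all $x\in\Delta$ and $\langle vB:B\in\mathcal{B}\rangle\subseteq\langle\Delta\rangle$. -}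

module Defs where

open import Level using (0ℓ)
open import Data.Nat using (ℕ; zero; suc; NonZero) renaming (_+_ to _+ℕ_; _*_ to _*ℕ_; _∸_ to _∸ℕ_)
open import Data.Nat.DivMod using (_mod_)
open import Data.Fin using (Fin; toℕ)
open import Data.Vec using (Vec; []; _∷_; zipWith; replicate; fromList; transpose; map)
open import Data.List using (List; length)
open import Data.List.Membership.Propositional using (_∈_)
open import Data.List.Relation.Unary.All using (All)
open import Data.Product using (Σ; _×_; proj₁; proj₂)
open import Relation.Binary.PropositionalEquality using (_≡_)

module _ (p : ℕ) .{{_ : NonZero p}} where

  F : Set
  F = Fin p

  0F : F
  0F = 0 mod p

  _+F_ : F → F → F
  a +F b = (toℕ a +ℕ toℕ b) mod p

  _*F_ : F → F → F
  a *F b = (toℕ a *ℕ toℕ b) mod p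

  -F_ : F → F
  -F a = (p ∸ℕ toℕ a) mod p

  Vect : ℕ → Set
  Vect k = Vec F k

  -- m × n matrices, as a list of m rows
  Mat : ℕ → ℕ → Set
  Mat m n = Vec (Vect n) m

  zeroV : ∀ {k} → Vect k
  zeroV {k} = replicate k 0F

  _+V_ : ∀ {k} → Vect k → Vect k → Vect k
  _+V_ = zipWith _+F_

  _·V_ : ∀ {k} → F → Vect k → Vect k
  c ·V v = map (c *F_) v

  lc : ∀ {k l} → Vec F l → Vec (Vect k) l → Vect k
  lc [] [] = zeroV
  lc (c ∷ cs) (w ∷ ws) = (c ·V w) +V lc cs ws

  dot : ∀ {k} → Vect k → Vect k → F
  dot [] [] = 0F
  dot (x ∷ xs) (y ∷ ys) = (x *F y) +F dot xs ys

  _⋆_ : ∀ {m n} → Vect m → Mat m n → Vect n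
  v ⋆ A = lc v A

  InSpanP : ∀ {k} → (Vect k → Set) → Vect k → Set
  InSpanP {k} S v = Σ ℕ λ l → Σ (Vec F l) λ c → Σ (Vec (Vect k) l) λ ws →
                      All′ ws × (v ≡ lc c ws)
    where
    All′ : ∀ {l} → Vec (Vect k) l → Set
    All′ [] = Data.Unit.⊤ where import Data.Unit
    All′ (w ∷ ws) = S w × All′ ws

  InSpan : ∀ {k} → List (Vect k) → Vect k → Set
  InSpan Λ = InSpanP (_∈ Λ)

  LinIndepV : ∀ {k l} → Vec (Vect k) l → Set
  LinIndepV {l = l} ws = ∀ (c : Vec F l) → lc c ws ≡ zeroV → c ≡ replicate l 0F

  AttrSet : ∀ {k} → List (Vect k) → Set
  AttrSet Λ = LinIndepV (fromList Λ)

  _⊆_ : ∀ {k} → List (Vect k) → List (Vect k) → Set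
  Λ ⊆ Λ′ = All (_∈ Λ′) Λ

  record MatSpace (m n : ℕ) : Set₁ where
    field
      _∈M     : Mat m n → Set
      zero∈  : replicate m zeroV ∈M
      add∈   : ∀ {A B} → A ∈M → B ∈M → zipWith _+V_ A B ∈M
      smul∈  : ∀ c {A} → A ∈M → map (c ·V_) A ∈M
  open MatSpace public

  Skew : ∀ {n} → Mat n n → Set
  Skew B = transpose B ≡ map (map -F_) B

  record SkewSpace (n : ℕ) : Set₁ where
    field
      space   : MatSpace n n
      allSkew : ∀ B → _∈M space B → Skew B
  open SkewSpace public

  KerGen : ∀ {m n} → MatSpace m n → List (Vect n) → Vect m → Set
  KerGen 𝒜 Λ v = ∀ A → _∈M 𝒜 A → InSpan Λ (v ⋆ A)

  Ker : ∀ {m n} → MatSpace m n → List (Vect n) → Vect m → Set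
  Ker 𝒜 Λ = InSpanP (KerGen 𝒜 Λ)

  KerSkewGen : ∀ {n} → SkewSpace n → List (Vect n) → Vect n → Set
  KerSkewGen ℬ Δ v = (∀ x → x ∈ Δ → dot x v ≡ 0F)
                   × (∀ B → _∈M (space ℬ) B → InSpan Δ (v ⋆ B))

  KerSkew : ∀ {n} → SkewSpace n → List (Vect n) → Vect n → Set
  KerSkew ℬ Δ = InSpanP (KerSkewGen ℬ Δ)

  HasDim : ∀ {k} → (Vect k → Set) → ℕ → Set
  HasDim {k} W d = Σ (Vec (Vect k) d) λ bs →
                     All′ bs × LinIndepV bs × (∀ v → W v → InSpanP (λ w → w ∈ᵥ bs) v)
    where
    All′ : ∀ {l} → Vec (Vect k) l → Set
    All′ [] = Data.Unit.⊤ where import Data.Unit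
    All′ (w ∷ ws) = W w × All′ ws
    _∈ᵥ_ : ∀ {l} → Vect k → Vec (Vect k) l → Set
    w ∈ᵥ bs = Data.Vec.Membership.Propositional._∈_ w bs
      where import Data.Vec.Membership.Propositional

module Submission where

-- Part (1) is monotonicity of spans: ⟨Λ⟩ ⊆ ⟨Λ′⟩, so every generator of ker(𝒜, Λ) generates ker(𝒜, Λ′).
--
-- For part (2), a vector v of ker_skew(ℬ, Δ) that is moreover orthogonal to the elements of Δ′ outside Δ lies in
-- ker_skew(ℬ, Δ′), since vB ∈ ⟨Δ⟩ ⊆ ⟨Δ′⟩. Each orthogonality condition is a linear functional g, and cutting an
-- independent family u₀, u₁, … down to ker g costs at most one vector: if g u₀ ≠ 0, the pivots g(u₀)uᵢ − g(uᵢ)u₀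
-- (i ≥ 1) lie in ker g and stay independent. Starting from a basis of ker_skew(ℬ, Δ) this yields an independent
-- family of size d − |Δ′ ∖ Δ| inside ker_skew(ℬ, Δ′), so d − |Δ′ ∖ Δ| ≤ d′ by the Steinitz bound (an independent
-- family in the span of b vectors has at most b members). Finally |Δ| ≤ |Δ′| − |Δ′ ∖ Δ|, again by the Steinitz
-- bound, since the independent family Δ lies among the members of Δ′ that belong to Δ.

open import Defs
open import Level using (0ℓ)
open import Algebra.Bundles using (CommutativeRing)
open import Data.Empty using (⊥-elim)
open import Data.Fin using (toℕ; _≟_)
open import Data.Fin.Properties using (toℕ-injective; toℕ-fromℕ<; toℕ<n)
open import Data.List using (List; []; _∷_; length; filter)
open import Data.List.Membership.Propositional using (_∈_)
open import Data.List.Membership.Propositional.Properties using (∈-filter⁺)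
import Data.List.Membership.DecPropositional
open import Data.List.Relation.Unary.All using (All; []; _∷_)
import Data.List.Relation.Unary.All as All
open import Data.Nat using (ℕ; zero; suc; NonZero; _%_; _<_; _≤_; z≤n; s≤s)
import Data.Nat as ℕ
import Data.Nat.Properties as ℕₚ
open import Data.Nat.DivMod using (_mod_; %-distribˡ-+; %-distribˡ-*; m<n⇒m%n≡m; n%n≡0)
open import Data.Nat.Divisibility using (_∣_; n∣m⇒m%n≡0; m%n≡0⇒n∣m)
open import Data.Nat.Primality using (Prime; euclidsLemma; prime⇒nonTrivial)
open import Data.Product using (Σ; _,_; _×_; proj₁; proj₂)
open import Data.Sum using (_⊎_; inj₁; inj₂)
open import Data.Unit using (⊤; tt)
open import Data.Vec using (Vec; []; _∷_; replicate; map; head; tail; fromList)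
open import Data.Vec.Membership.Propositional using () renaming (_∈_ to _∈ᵥ_)
open import Data.Vec.Membership.Propositional.Properties using (∈-fromList⁺)
open import Data.Vec.Properties
  using (≡-dec; ∷-injectiveˡ; ∷-injectiveʳ; zipWith-assoc; zipWith-comm; zipWith-identityˡ; zipWith-identityʳ;
         map-replicate; map-cong; map-id)
open import Data.Vec.Relation.Unary.All as AllV using ([]; _∷_) renaming (All to AllV)
open import Data.Vec.Relation.Unary.All.Properties using (fromList⁺)
open import Data.Vec.Relation.Unary.Any using (here; there)
open import Relation.Binary.PropositionalEquality
  using (_≡_; refl; sym; trans; cong; cong₂; subst; isEquivalence; module ≡-Reasoning)
open import Relation.Nullary using (¬_; yes; no)
open import Relation.Unary using (Decidable)
open import Relation.Unary.Properties using (∁?)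

module Residues (p : ℕ) .{{_ : NonZero p}} where

  open ≡-Reasoning

  [_] : ℕ → F p
  [ x ] = x mod p

  toℕ-[] : ∀ x → toℕ [ x ] ≡ x % p
  toℕ-[] x = toℕ-fromℕ< _

  []-toℕ : ∀ a → [ toℕ a ] ≡ a
  []-toℕ a = toℕ-injective (trans (toℕ-[] (toℕ a)) (m<n⇒m%n≡m (toℕ<n a)))

  []-≡ : ∀ {x y} → x % p ≡ y % p → [ x ] ≡ [ y ]
  []-≡ {x} {y} eq = toℕ-injective (trans (toℕ-[] x) (trans eq (sym (toℕ-[] y))))

  infixl 6 _+_
  infixl 7 _*_
  _+_ : F p → F p → F p
  _+_ = _+F_ p
  _*_ : F p → F p → F p
  _*_ = _*F_ p

  []-+ : ∀ x y → [ x ] + [ y ] ≡ [ x ℕ.+ y ]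
  []-+ x y = trans (cong₂ (λ m n → [ m ℕ.+ n ]) (toℕ-[] x) (toℕ-[] y)) ([]-≡ (sym (%-distribˡ-+ x y p)))

  []-* : ∀ x y → [ x ] * [ y ] ≡ [ x ℕ.* y ]
  []-* x y = trans (cong₂ (λ m n → [ m ℕ.* n ]) (toℕ-[] x) (toℕ-[] y)) ([]-≡ (sym (%-distribˡ-* x y p)))

  []-+ˡ : ∀ x b → [ x ] + b ≡ [ x ℕ.+ toℕ b ]
  []-+ˡ x b = trans (cong ([ x ] +_) (sym ([]-toℕ b))) ([]-+ x (toℕ b))

  []-+ʳ : ∀ a y → a + [ y ] ≡ [ toℕ a ℕ.+ y ]
  []-+ʳ a y = trans (cong (_+ [ y ]) (sym ([]-toℕ a))) ([]-+ (toℕ a) y)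

  []-*ˡ : ∀ x b → [ x ] * b ≡ [ x ℕ.* toℕ b ]
  []-*ˡ x b = trans (cong ([ x ] *_) (sym ([]-toℕ b))) ([]-* x (toℕ b))

  []-*ʳ : ∀ a y → a * [ y ] ≡ [ toℕ a ℕ.* y ]
  []-*ʳ a y = trans (cong (_* [ y ]) (sym ([]-toℕ a))) ([]-* (toℕ a) y)

  private
    +-assoc : ∀ a b c → (a + b) + c ≡ a + (b + c)
    +-assoc a b c = begin
      [ toℕ a ℕ.+ toℕ b ] + c          ≡⟨ []-+ˡ _ c ⟩
      [ toℕ a ℕ.+ toℕ b ℕ.+ toℕ c ]    ≡⟨ cong [_] (ℕₚ.+-assoc (toℕ a) _ _) ⟩
      [ toℕ a ℕ.+ (toℕ b ℕ.+ toℕ c) ]  ≡⟨ []-+ʳ a _ ⟨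
      a + [ toℕ b ℕ.+ toℕ c ]          ∎

    *-assoc : ∀ a b c → (a * b) * c ≡ a * (b * c)
    *-assoc a b c = begin
      [ toℕ a ℕ.* toℕ b ] * c          ≡⟨ []-*ˡ _ c ⟩
      [ toℕ a ℕ.* toℕ b ℕ.* toℕ c ]    ≡⟨ cong [_] (ℕₚ.*-assoc (toℕ a) _ _) ⟩
      [ toℕ a ℕ.* (toℕ b ℕ.* toℕ c) ]  ≡⟨ []-*ʳ a _ ⟨
      a * [ toℕ b ℕ.* toℕ c ]          ∎

    +-comm : ∀ a b → a + b ≡ b + a
    +-comm a b = cong [_] (ℕₚ.+-comm (toℕ a) (toℕ b))

    *-comm : ∀ a b → a * b ≡ b * a
    *-comm a b = cong [_] (ℕₚ.*-comm (toℕ a) (toℕ b))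

    +-identityˡ : ∀ a → [ 0 ] + a ≡ a
    +-identityˡ a = trans ([]-+ˡ 0 a) ([]-toℕ a)

    *-identityˡ : ∀ a → [ 1 ] * a ≡ a
    *-identityˡ a = trans ([]-*ˡ 1 a) (trans (cong [_] (ℕₚ.*-identityˡ (toℕ a))) ([]-toℕ a))

    -‿inverseʳ : ∀ a → a + -F_ p a ≡ [ 0 ]
    -‿inverseʳ a = begin
      a + [ p ℕ.∸ toℕ a ]          ≡⟨ []-+ʳ a _ ⟩
      [ toℕ a ℕ.+ (p ℕ.∸ toℕ a) ]  ≡⟨ cong [_] (ℕₚ.m+[n∸m]≡n (ℕₚ.<⇒≤ (toℕ<n a))) ⟩
      [ p ]                         ≡⟨ []-≡ (trans (n%n≡0 p) (sym (m<n⇒m%n≡m (ℕ.>-nonZero⁻¹ p)))) ⟩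
      [ 0 ]                         ∎

    distribˡ : ∀ a b c → a * (b + c) ≡ a * b + a * c
    distribˡ a b c = begin
      a * [ toℕ b ℕ.+ toℕ c ]                 ≡⟨ []-*ʳ a _ ⟩
      [ toℕ a ℕ.* (toℕ b ℕ.+ toℕ c) ]          ≡⟨ cong [_] (ℕₚ.*-distribˡ-+ (toℕ a) _ _) ⟩
      [ toℕ a ℕ.* toℕ b ℕ.+ toℕ a ℕ.* toℕ c ]  ≡⟨ []-+ _ _ ⟨
      a * b + a * c                            ∎

  ring : CommutativeRing 0ℓ 0ℓ
  ring = record
    { Carrier = F p
    ; _≈_ = _≡_
    ; _+_ = _+_
    ; _*_ = _*_
    ; -_ = -F_ p
    ; 0# = [ 0 ]
    ; 1# = [ 1 ]
    ; isCommutativeRing = record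
      { isRing = record
        { +-isAbelianGroup = record
          { isGroup = record
            { isMonoid = record
              { isSemigroup = record
                { isMagma = record { isEquivalence = isEquivalence ; ∙-cong = cong₂ _+_ }
                ; assoc = +-assoc }
              ; identity = +-identityˡ , λ a → trans (+-comm a _) (+-identityˡ a) }
            ; inverse = (λ a → trans (+-comm _ a) (-‿inverseʳ a)) , -‿inverseʳ
            ; ⁻¹-cong = cong (-F_ p) }
          ; comm = +-comm }
        ; *-cong = cong₂ _*_
        ; *-assoc = *-assoc
        ; *-identity = *-identityˡ , λ a → trans (*-comm a _) (*-identityˡ a)
        ; distrib = distribˡ , λ a b c → trans (*-comm _ a) (trans (distribˡ a b c) (cong₂ _+_ (*-comm a b) (*-comm a c)))
        }
      ; *-comm = *-comm
      }
    }

  module _ (p-prime : Prime p) where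

    private
      toℕ-[0] : toℕ [ 0 ] ≡ 0
      toℕ-[0] = trans (toℕ-[] 0) (m<n⇒m%n≡m (ℕ.>-nonZero⁻¹ p))

      p∣⇒≡[0] : ∀ a → p ∣ toℕ a → a ≡ [ 0 ]
      p∣⇒≡[0] a p∣a = toℕ-injective (begin
        toℕ a      ≡⟨ sym (m<n⇒m%n≡m (toℕ<n a)) ⟩
        toℕ a % p  ≡⟨ n∣m⇒m%n≡0 (toℕ a) p p∣a ⟩
        0          ≡⟨ sym toℕ-[0] ⟩
        toℕ [ 0 ]  ∎)

    [1]≢[0] : ¬ [ 1 ] ≡ [ 0 ]
    [1]≢[0] eq = ℕₚ.1+n≢0 (begin
      1          ≡⟨ m<n⇒m%n≡m (ℕ.nonTrivial⇒n>1 p {{prime⇒nonTrivial p-prime}}) ⟨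
      1 % p      ≡⟨ toℕ-[] 1 ⟨
      toℕ [ 1 ]  ≡⟨ cong toℕ eq ⟩
      toℕ [ 0 ]  ≡⟨ toℕ-[0] ⟩
      0          ∎)

    x*y≡0⇒x≡0∨y≡0 : ∀ a b → a * b ≡ [ 0 ] → a ≡ [ 0 ] ⊎ b ≡ [ 0 ]
    x*y≡0⇒x≡0∨y≡0 a b eq with euclidsLemma (toℕ a) (toℕ b) p-prime p∣ab
      where
      p∣ab : p ∣ toℕ a ℕ.* toℕ b
      p∣ab = m%n≡0⇒n∣m _ p (trans (sym (toℕ-[] _)) (trans (cong toℕ eq) toℕ-[0]))
    ... | inj₁ p∣a = inj₁ (p∣⇒≡[0] a p∣a)
    ... | inj₂ p∣b = inj₂ (p∣⇒≡[0] b p∣b)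

module Vectors (p : ℕ) .{{_ : NonZero p}} where

  open CommutativeRing (Residues.ring p) public
    using (_+_; _*_; -_; 0#; 1#; +-assoc; +-comm; +-identityˡ; +-identityʳ; -‿inverseʳ;
           *-assoc; *-comm; *-identityˡ; distribˡ; distribʳ; zeroˡ; zeroʳ; +-commutativeSemigroup)
  open import Algebra.Properties.CommutativeSemigroup +-commutativeSemigroup using (interchange)

  V : ℕ → Set
  V = Vect p

  infixl 6 _+ᵛ_
  infixr 7 _·ᵛ_
  _+ᵛ_ : ∀ {k} → V k → V k → V k
  _+ᵛ_ = _+V_ p
  _·ᵛ_ : ∀ {k} → F p → V k → V k
  _·ᵛ_ = _·V_ p
  0ᵛ : ∀ {k} → V k
  0ᵛ = zeroV p

  +ᵛ-assoc : ∀ {k} (u v w : V k) → (u +ᵛ v) +ᵛ w ≡ u +ᵛ (v +ᵛ w)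
  +ᵛ-assoc = zipWith-assoc +-assoc

  +ᵛ-comm : ∀ {k} (u v : V k) → u +ᵛ v ≡ v +ᵛ u
  +ᵛ-comm = zipWith-comm +-comm

  +ᵛ-identityˡ : ∀ {k} (u : V k) → 0ᵛ +ᵛ u ≡ u
  +ᵛ-identityˡ = zipWith-identityˡ +-identityˡ

  +ᵛ-identityʳ : ∀ {k} (u : V k) → u +ᵛ 0ᵛ ≡ u
  +ᵛ-identityʳ = zipWith-identityʳ +-identityʳ

  +ᵛ-interchange : ∀ {k} (u v w x : V k) → (u +ᵛ v) +ᵛ (w +ᵛ x) ≡ (u +ᵛ w) +ᵛ (v +ᵛ x)
  +ᵛ-interchange [] [] [] [] = refl
  +ᵛ-interchange (a ∷ u) (b ∷ v) (c ∷ w) (d ∷ x) = cong₂ _∷_ (interchange a b c d) (+ᵛ-interchange u v w x)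

  ·ᵛ-distribˡ : ∀ {k} s (u v : V k) → s ·ᵛ (u +ᵛ v) ≡ s ·ᵛ u +ᵛ s ·ᵛ v
  ·ᵛ-distribˡ s [] [] = refl
  ·ᵛ-distribˡ s (a ∷ u) (b ∷ v) = cong₂ _∷_ (distribˡ s a b) (·ᵛ-distribˡ s u v)

  ·ᵛ-distribʳ : ∀ {k} s t (u : V k) → (s + t) ·ᵛ u ≡ s ·ᵛ u +ᵛ t ·ᵛ u
  ·ᵛ-distribʳ s t [] = refl
  ·ᵛ-distribʳ s t (a ∷ u) = cong₂ _∷_ (distribʳ a s t) (·ᵛ-distribʳ s t u)

  ·ᵛ-assoc : ∀ {k} s t (u : V k) → s ·ᵛ t ·ᵛ u ≡ (s * t) ·ᵛ u
  ·ᵛ-assoc s t [] = refl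
  ·ᵛ-assoc s t (a ∷ u) = cong₂ _∷_ (sym (*-assoc s t a)) (·ᵛ-assoc s t u)

  ·ᵛ-zeroˡ : ∀ {k} (u : V k) → 0# ·ᵛ u ≡ 0ᵛ
  ·ᵛ-zeroˡ [] = refl
  ·ᵛ-zeroˡ (a ∷ u) = cong₂ _∷_ (zeroˡ a) (·ᵛ-zeroˡ u)

  ·ᵛ-zeroʳ : ∀ {k} s → s ·ᵛ 0ᵛ {k} ≡ 0ᵛ
  ·ᵛ-zeroʳ {k} s = trans (map-replicate (s *_) 0# k) (cong (replicate k) (zeroʳ s))

  ·ᵛ-identityˡ : ∀ {k} (u : V k) → 1# ·ᵛ u ≡ u
  ·ᵛ-identityˡ u = trans (map-cong *-identityˡ u) (map-id u)

  lc-zeroˡ : ∀ {k l} (ws : Vec (V k) l) → lc p (replicate l 0#) ws ≡ 0ᵛ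
  lc-zeroˡ [] = refl
  lc-zeroˡ (w ∷ ws) = trans (cong₂ _+ᵛ_ (·ᵛ-zeroˡ w) (lc-zeroˡ ws)) (+ᵛ-identityˡ 0ᵛ)

  lc-+ : ∀ {k l} (c c′ : Vec (F p) l) (ws : Vec (V k) l) → lc p (c +ᵛ c′) ws ≡ lc p c ws +ᵛ lc p c′ ws
  lc-+ [] [] [] = sym (+ᵛ-identityˡ 0ᵛ)
  lc-+ (a ∷ c) (b ∷ c′) (w ∷ ws) =
    trans (cong₂ _+ᵛ_ (·ᵛ-distribʳ a b w) (lc-+ c c′ ws)) (+ᵛ-interchange _ _ _ _)

  lc-· : ∀ {k l} s (c : Vec (F p) l) (ws : Vec (V k) l) → lc p (s ·ᵛ c) ws ≡ s ·ᵛ lc p c ws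
  lc-· s [] [] = sym (·ᵛ-zeroʳ s)
  lc-· s (a ∷ c) (w ∷ ws) =
    trans (cong₂ _+ᵛ_ (sym (·ᵛ-assoc s a w)) (lc-· s c ws)) (sym (·ᵛ-distribˡ s _ _))

  lc-lc : ∀ {k b l} (c : Vec (F p) l) (es : Vec (Vec (F p) b) l) (w : Vec (V k) b) →
          lc p c (map (λ e → lc p e w) es) ≡ lc p (lc p c es) w
  lc-lc [] [] w = sym (lc-zeroˡ w)
  lc-lc (a ∷ c) (e ∷ es) w =
    trans (cong₂ _+ᵛ_ (sym (lc-· a e w)) (lc-lc c es w)) (sym (lc-+ (a ·ᵛ e) (lc p c es) w))

  dot-+ʳ : ∀ {k} (x u v : V k) → dot p x (u +ᵛ v) ≡ dot p x u + dot p x v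
  dot-+ʳ [] [] [] = sym (+-identityˡ 0#)
  dot-+ʳ (x ∷ xs) (a ∷ u) (b ∷ v) =
    trans (cong₂ _+_ (distribˡ x a b) (dot-+ʳ xs u v)) (interchange (x * a) (x * b) (dot p xs u) (dot p xs v))

  dot-·ʳ : ∀ {k} (x : V k) s (u : V k) → dot p x (s ·ᵛ u) ≡ s * dot p x u
  dot-·ʳ [] s [] = sym (zeroʳ s)
  dot-·ʳ (x ∷ xs) s (a ∷ u) = trans (cong₂ _+_ (x*[s*a]≡s*[x*a]) (dot-·ʳ xs s u)) (sym (distribˡ s _ _))
    where
    x*[s*a]≡s*[x*a] : x * (s * a) ≡ s * (x * a)
    x*[s*a]≡s*[x*a] = trans (sym (*-assoc x s a)) (trans (cong (_* a) (*-comm x s)) (*-assoc s x a))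

  record IsLinear {k} (g : V k → F p) : Set where
    field
      +-hom : ∀ u v → g (u +ᵛ v) ≡ g u + g v
      ·-hom : ∀ s u → g (s ·ᵛ u) ≡ s * g u

  dot-isLinear : ∀ {k} (x : V k) → IsLinear (dot p x)
  dot-isLinear x = record { +-hom = dot-+ʳ x ; ·-hom = dot-·ʳ x }

  record IsSubspace {k} (P : V k → Set) : Set where
    field
      0∈ : P 0ᵛ
      +∈ : ∀ {u v} → P u → P v → P (u +ᵛ v)
      ·∈ : ∀ s {u} → P u → P (s ·ᵛ u)

  open IsSubspace

  ∩-isSubspace : ∀ {k} {P Q : V k → Set} → IsSubspace P → IsSubspace Q → IsSubspace (λ v → P v × Q v)
  ∩-isSubspace P Q = record
    { 0∈ = 0∈ P , 0∈ Q
    ; +∈ = λ (pu , qu) (pv , qv) → +∈ P pu pv , +∈ Q qu qv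
    ; ·∈ = λ s (pu , qu) → ·∈ P s pu , ·∈ Q s qu
    }

  Π-isSubspace : ∀ {k} {A : Set} {Q : A → V k → Set} → (∀ i → IsSubspace (Q i)) → IsSubspace (λ v → ∀ i → Q i v)
  Π-isSubspace Q = record
    { 0∈ = λ i → 0∈ (Q i)
    ; +∈ = λ qu qv i → +∈ (Q i) (qu i) (qv i)
    ; ·∈ = λ s qu i → ·∈ (Q i) s (qu i)
    }

  ⋆-preimage-isSubspace : ∀ {m n} {P : V n → Set} (A : Mat p m n) → IsSubspace P → IsSubspace (λ v → P (_⋆_ p v A))
  ⋆-preimage-isSubspace {P = P} A P-sub = record
    { 0∈ = subst P (sym (lc-zeroˡ A)) (0∈ P-sub)
    ; +∈ = λ {u} {v} Pu Pv → subst P (sym (lc-+ u v A)) (+∈ P-sub Pu Pv)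
    ; ·∈ = λ s {u} Pu → subst P (sym (lc-· s u A)) (·∈ P-sub s Pu)
    }

  kernel-isSubspace : ∀ {k} {g : V k → F p} → IsLinear g → IsSubspace (λ v → g v ≡ 0#)
  kernel-isSubspace {g = g} lin = record
    { 0∈ = trans (cong g (sym (·ᵛ-zeroˡ 0ᵛ))) (trans (·-hom 0# 0ᵛ) (zeroˡ _))
    ; +∈ = λ {u} {v} gu gv → trans (+-hom u v) (trans (cong₂ _+_ gu gv) (+-identityˡ 0#))
    ; ·∈ = λ s {u} gu → trans (·-hom s u) (trans (cong (s *_) gu) (zeroʳ s))
    }
    where open IsLinear lin

  -- InSpanP's membership predicate is local to Defs, so recursion re-packs the tail of a representation.
  InSpanP-mono : ∀ {k} {S S′ : V k → Set} → (∀ {x} → S x → S′ x) → ∀ {v} → InSpanP p S v → InSpanP p S′ v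
  InSpanP-mono f (zero , [] , [] , _ , e) = zero , [] , [] , _ , e
  InSpanP-mono f (suc l , c ∷ cs , w ∷ ws , (s , rest) , e) with InSpanP-mono f (l , cs , ws , rest , refl)
  ... | l′ , cs′ , ws′ , rest′ , e′ = suc l′ , c ∷ cs′ , w ∷ ws′ , (f s , rest′) , trans e (cong (c ·ᵛ w +ᵛ_) e′)

  InSpanP-least : ∀ {k} {S P : V k → Set} → IsSubspace P → (∀ {x} → S x → P x) → ∀ {v} → InSpanP p S v → P v
  InSpanP-least P f (zero , [] , [] , _ , refl) = 0∈ P
  InSpanP-least P f (suc l , c ∷ cs , w ∷ ws , (s , rest) , refl) =
    +∈ P (·∈ P c (f s)) (InSpanP-least P f (l , cs , ws , rest , refl))

  InSpanP-∈ : ∀ {k} {S : V k → Set} {v} → S v → InSpanP p S v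
  InSpanP-∈ {v = v} s = 1 , 1# ∷ [] , v ∷ [] , (s , _) , sym (trans (+ᵛ-identityʳ (1# ·ᵛ v)) (·ᵛ-identityˡ v))

  InSpanP-isSubspace : ∀ {k} (S : V k → Set) → IsSubspace (InSpanP p S)
  InSpanP-isSubspace S = record
    { 0∈ = zero , [] , [] , _ , refl
    ; +∈ = InSpanP-+
    ; ·∈ = λ s (l , c , ws , all , e) → l , s ·ᵛ c , ws , all , trans (cong (s ·ᵛ_) e) (sym (lc-· s c ws))
    }
    where
    InSpanP-+ : ∀ {u v} → InSpanP p S u → InSpanP p S v → InSpanP p S (u +ᵛ v)
    InSpanP-+ {v = v} (zero , [] , [] , _ , refl) h = subst (InSpanP p S) (sym (+ᵛ-identityˡ v)) h
    InSpanP-+ (suc l , c ∷ cs , w ∷ ws , (s , rest) , refl) h with InSpanP-+ (l , cs , ws , rest , refl) h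
    ... | l′ , cs′ , ws′ , rest′ , e′ =
      suc l′ , c ∷ cs′ , w ∷ ws′ , (s , rest′) , trans (+ᵛ-assoc _ _ _) (cong (c ·ᵛ w +ᵛ_) e′)

  Ker-mono : ∀ {m n} (𝒜 : MatSpace p m n) {Λ Λ′ : List (V n)} → _⊆_ p Λ Λ′ → ∀ {v} → Ker p 𝒜 Λ v → Ker p 𝒜 Λ′ v
  Ker-mono 𝒜 Λ⊆Λ′ = InSpanP-mono (λ gen A A∈𝒜 → InSpanP-mono (All.lookup Λ⊆Λ′) (gen A A∈𝒜))

  infix 4 _∈⟨_⟩
  _∈⟨_⟩ : ∀ {k b} → V k → Vec (V k) b → Set
  v ∈⟨ w ⟩ = Σ (Vec (F p) _) λ c → v ≡ lc p c w

  ∈⟨⟩-isSubspace : ∀ {k b} (w : Vec (V k) b) → IsSubspace (_∈⟨ w ⟩)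
  ∈⟨⟩-isSubspace w = record
    { 0∈ = replicate _ 0# , sym (lc-zeroˡ w)
    ; +∈ = λ { (c , refl) (c′ , refl) → c +ᵛ c′ , sym (lc-+ c c′ w) }
    ; ·∈ = λ { s (c , refl) → s ·ᵛ c , sym (lc-· s c w) }
    }

  ∈⇒∈⟨⟩ : ∀ {k b} {w : Vec (V k) b} {x} → x ∈ᵥ w → x ∈⟨ w ⟩
  ∈⇒∈⟨⟩ {w = x ∷ ws} (here refl) =
    1# ∷ replicate _ 0# , sym (trans (cong₂ _+ᵛ_ (·ᵛ-identityˡ x) (lc-zeroˡ ws)) (+ᵛ-identityʳ x))
  ∈⇒∈⟨⟩ {w = w ∷ ws} (there x∈ws) with ∈⇒∈⟨⟩ x∈ws
  ... | c , refl = 0# ∷ c , sym (trans (cong (_+ᵛ lc p c ws) (·ᵛ-zeroˡ w)) (+ᵛ-identityˡ _))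

module Dimension (p : ℕ) .{{_ : NonZero p}} (p-prime : Prime p) where

  open Vectors p
  open Residues p using ([1]≢[0]; x*y≡0⇒x≡0∨y≡0)
  open IsSubspace
  open IsLinear

  linIndep-tail : ∀ {k l} {u : V k} {us : Vec (V k) l} → LinIndepV p (u ∷ us) → LinIndepV p us
  linIndep-tail {u = u} li c eq = ∷-injectiveʳ (li (0# ∷ c) (trans (cong₂ _+ᵛ_ (·ᵛ-zeroˡ u) eq) (+ᵛ-identityˡ 0ᵛ)))

  ·ᵛ-cancel : ∀ {l} {s} → ¬ s ≡ 0# → (c : Vec (F p) l) → s ·ᵛ c ≡ 0ᵛ → c ≡ 0ᵛ
  ·ᵛ-cancel s≢0 [] eq = refl
  ·ᵛ-cancel {s = s} s≢0 (a ∷ c) eq with x*y≡0⇒x≡0∨y≡0 p-prime s a (∷-injectiveˡ eq)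
  ... | inj₁ s≡0 = ⊥-elim (s≢0 s≡0)
  ... | inj₂ a≡0 = cong₂ _∷_ a≡0 (·ᵛ-cancel s≢0 c (∷-injectiveʳ eq))

  infix 4 ⟨_⟩⊆⟨_⟩
  ⟨_⟩⊆⟨_⟩ : ∀ {k a b} → Vec (V k) a → Vec (V k) b → Set
  ⟨ u′ ⟩⊆⟨ u ⟩ = ∀ c → lc p c u′ ∈⟨ u ⟩

  linIndep-∷ : ∀ {k a b} {u : V k} {us : Vec (V k) a} {us′ : Vec (V k) b} →
               LinIndepV p (u ∷ us) → ⟨ us′ ⟩⊆⟨ us ⟩ → LinIndepV p us′ → LinIndepV p (u ∷ us′)
  linIndep-∷ {u = u} {us} {us′} li us′⊆us li′ (c₀ ∷ c) eq = cong₂ _∷_ (∷-injectiveˡ e≡0) (li′ c lc≡0)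
    where
    e = proj₁ (us′⊆us c)
    e≡0 : c₀ ∷ e ≡ 0ᵛ
    e≡0 = li (c₀ ∷ e) (trans (cong (c₀ ·ᵛ u +ᵛ_) (sym (proj₂ (us′⊆us c)))) eq)
    lc≡0 : lc p c us′ ≡ 0ᵛ
    lc≡0 = trans (proj₂ (us′⊆us c)) (trans (cong (λ e → lc p e us) (∷-injectiveʳ e≡0)) (lc-zeroˡ us))

  module Pivot {k} (g : V k → F p) (lin : IsLinear g) (u₀ : V k) where

    pivot : V k → V k
    pivot w = g u₀ ·ᵛ w +ᵛ (- g w) ·ᵛ u₀

    g∘pivot≡0 : ∀ w → g (pivot w) ≡ 0#
    g∘pivot≡0 w = begin
      g (g u₀ ·ᵛ w +ᵛ (- g w) ·ᵛ u₀)     ≡⟨ +-hom lin _ _ ⟩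
      g (g u₀ ·ᵛ w) + g ((- g w) ·ᵛ u₀)  ≡⟨ cong₂ _+_ (·-hom lin (g u₀) w) (·-hom lin (- g w) u₀) ⟩
      g u₀ * g w + (- g w) * g u₀        ≡⟨ cong (_+ (- g w) * g u₀) (*-comm (g u₀) (g w)) ⟩
      g w * g u₀ + (- g w) * g u₀        ≡⟨ sym (distribʳ (g u₀) (g w) (- g w)) ⟩
      (g w + - g w) * g u₀               ≡⟨ cong (_* g u₀) (-‿inverseʳ (g w)) ⟩
      0# * g u₀                          ≡⟨ zeroˡ (g u₀) ⟩
      0#                                 ∎
      where open ≡-Reasoning

    u₀-coeff : ∀ {l} → Vec (F p) l → Vec (V k) l → F p
    u₀-coeff c ws = dot p c (map (λ w → - g w) ws)

    lc-pivot : ∀ {l} (c : Vec (F p) l) (ws : Vec (V k) l) →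
               lc p c (map pivot ws) ≡ lc p (u₀-coeff c ws ∷ g u₀ ·ᵛ c) (u₀ ∷ ws)
    lc-pivot [] [] = sym (trans (+ᵛ-identityʳ _) (·ᵛ-zeroˡ u₀))
    lc-pivot (a ∷ c) (w ∷ ws) = begin
      a ·ᵛ (g u₀ ·ᵛ w +ᵛ (- g w) ·ᵛ u₀) +ᵛ lc p c (map pivot ws)
        ≡⟨ cong₂ _+ᵛ_ (trans (·ᵛ-distribˡ a _ _) (cong₂ _+ᵛ_ (·ᵛ-assoc a (g u₀) w) (·ᵛ-assoc a (- g w) u₀)))
                      (lc-pivot c ws) ⟩
      ((a * g u₀) ·ᵛ w +ᵛ (a * - g w) ·ᵛ u₀) +ᵛ (u₀-coeff c ws ·ᵛ u₀ +ᵛ lc p (g u₀ ·ᵛ c) ws)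
        ≡⟨ cong (_+ᵛ (u₀-coeff c ws ·ᵛ u₀ +ᵛ lc p (g u₀ ·ᵛ c) ws)) (+ᵛ-comm ((a * g u₀) ·ᵛ w) _) ⟩
      ((a * - g w) ·ᵛ u₀ +ᵛ (a * g u₀) ·ᵛ w) +ᵛ (u₀-coeff c ws ·ᵛ u₀ +ᵛ lc p (g u₀ ·ᵛ c) ws)
        ≡⟨ +ᵛ-interchange _ _ _ _ ⟩
      ((a * - g w) ·ᵛ u₀ +ᵛ u₀-coeff c ws ·ᵛ u₀) +ᵛ ((a * g u₀) ·ᵛ w +ᵛ lc p (g u₀ ·ᵛ c) ws)
        ≡⟨ cong₂ _+ᵛ_ (sym (·ᵛ-distribʳ (a * - g w) (u₀-coeff c ws) u₀))
                      (cong (λ s → s ·ᵛ w +ᵛ lc p (g u₀ ·ᵛ c) ws) (*-comm a (g u₀))) ⟩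
      (a * - g w + u₀-coeff c ws) ·ᵛ u₀ +ᵛ ((g u₀ * a) ·ᵛ w +ᵛ lc p (g u₀ ·ᵛ c) ws) ∎
      where open ≡-Reasoning

    pivots-⊆ : ∀ {l} (ws : Vec (V k) l) → ⟨ map pivot ws ⟩⊆⟨ u₀ ∷ ws ⟩
    pivots-⊆ ws c = u₀-coeff c ws ∷ g u₀ ·ᵛ c , lc-pivot c ws

    pivots-linIndep : ∀ {l} {ws : Vec (V k) l} → ¬ g u₀ ≡ 0# → LinIndepV p (u₀ ∷ ws) → LinIndepV p (map pivot ws)
    pivots-linIndep {ws = ws} g₀≢0 li c eq =
      ·ᵛ-cancel g₀≢0 c (∷-injectiveʳ (li (u₀-coeff c ws ∷ g u₀ ·ᵛ c) (trans (sym (lc-pivot c ws)) eq)))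

  record Independent {k} (P : V k → Set) : Set where
    constructor independent
    field
      {size}   : ℕ
      vectors  : Vec (V k) size
      members  : AllV P vectors
      linIndep : LinIndepV p vectors

  open Independent

  Independent-map : ∀ {k} {P Q : V k → Set} → (∀ {v} → P v → Q v) → Independent P → Independent Q
  Independent-map f (independent u Pu li) = independent u (AllV.map f Pu) li

  cut-by-kernel : ∀ {k a} {P : V k → Set} {g : V k → F p} → IsSubspace P → IsLinear g →
                  (u : Vec (V k) a) → AllV P u → LinIndepV p u →
                  Σ (Independent (λ v → P v × g v ≡ 0#)) λ J → a ≤ suc (size J) × ⟨ vectors J ⟩⊆⟨ u ⟩
  cut-by-kernel P-sub lin [] [] li = independent [] [] li , z≤n , λ { [] → [] , refl }
  cut-by-kernel {P = P} {g} P-sub lin (u₀ ∷ us) (Pu₀ ∷ Pus) li with g u₀ ≟ 0#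
  ... | no g₀≢0 = independent (map pivot us) (pivots-∈ Pus) (pivots-linIndep g₀≢0 li) , ℕₚ.≤-refl , pivots-⊆ us
    where
    open Pivot g lin u₀
    pivots-∈ : ∀ {l} {ws : Vec (V _) l} → AllV P ws → AllV (λ v → P v × g v ≡ 0#) (map pivot ws)
    pivots-∈ [] = []
    pivots-∈ {ws = w ∷ ws} (Pw ∷ Pws) =
      (+∈ P-sub (·∈ P-sub (g u₀) Pw) (·∈ P-sub (- g w) Pu₀) , g∘pivot≡0 w) ∷ pivots-∈ Pws
  ... | yes g₀≡0 with cut-by-kernel P-sub lin us Pus (linIndep-tail li)
  ...   | independent us′ Pus′ li′ , bound , us′⊆us =
    independent (u₀ ∷ us′) ((Pu₀ , g₀≡0) ∷ Pus′) (linIndep-∷ li us′⊆us li′) , s≤s bound , ⊆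
    where
    ⊆ : ⟨ u₀ ∷ us′ ⟩⊆⟨ u₀ ∷ us ⟩
    ⊆ (c₀ ∷ c) with us′⊆us c
    ... | e , eq = c₀ ∷ e , cong (c₀ ·ᵛ u₀ +ᵛ_) eq

  All-isSubspace : ∀ {k} {A : Set} {Q : A → V k → Set} → (∀ x → IsSubspace (Q x)) →
                   ∀ xs → IsSubspace (λ v → All (λ x → Q x v) xs)
  All-isSubspace Q-sub [] = record { 0∈ = [] ; +∈ = λ _ _ → [] ; ·∈ = λ _ _ → [] }
  All-isSubspace Q-sub (x ∷ xs) = record
    { 0∈ = 0∈ (Q-sub x) ∷ 0∈ rest
    ; +∈ = λ { (qu ∷ qus) (qv ∷ qvs) → +∈ (Q-sub x) qu qv ∷ +∈ rest qus qvs }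
    ; ·∈ = λ { s (qu ∷ qus) → ·∈ (Q-sub x) s qu ∷ ·∈ rest s qus }
    }
    where rest = All-isSubspace Q-sub xs

  cut-by-kernels : ∀ {k} {A : Set} {P : V k → Set} {g : A → V k → F p} → IsSubspace P → (∀ x → IsLinear (g x)) →
                   (xs : List A) (I : Independent P) →
                   Σ (Independent (λ v → P v × All (λ x → g x v ≡ 0#) xs)) λ J → size I ≤ size J ℕ.+ length xs
  cut-by-kernels P-sub lin [] I = Independent-map (_, []) I , ℕₚ.≤-reflexive (sym (ℕₚ.+-identityʳ _))
  cut-by-kernels {P = P} {g} P-sub lin (x ∷ xs) I with cut-by-kernels P-sub lin xs I
  ... | J , I≤J+xs with cut-by-kernel conds-sub (lin x) (vectors J) (members J) (linIndep J)
    where conds-sub = ∩-isSubspace P-sub (All-isSubspace (λ y → kernel-isSubspace (lin y)) xs)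
  ... | K , J≤1+K , _ = Independent-map (λ ((Pv , conds) , gxv≡0) → Pv , gxv≡0 ∷ conds) K , bound
    where
    open ℕₚ.≤-Reasoning
    bound : size I ≤ size K ℕ.+ suc (length xs)
    bound = begin
      size I                       ≤⟨ I≤J+xs ⟩
      size J ℕ.+ length xs         ≤⟨ ℕₚ.+-monoˡ-≤ (length xs) J≤1+K ⟩
      suc (size K) ℕ.+ length xs   ≡⟨ ℕₚ.+-suc (size K) (length xs) ⟨
      size K ℕ.+ suc (length xs)   ∎

  V₀-unique : (u : V 0) → u ≡ 0ᵛ
  V₀-unique [] = refl

  lc-heads-zero : ∀ {b a} {es : Vec (V (suc b)) a} → AllV (λ v → head v ≡ 0#) es →
                  ∀ c → lc p c es ≡ 0# ∷ lc p c (map tail es)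
  lc-heads-zero [] [] = refl
  lc-heads-zero {es = (x ∷ v) ∷ es} (x≡0 ∷ heads) (a ∷ c) =
    trans (cong (a ·ᵛ (x ∷ v) +ᵛ_) (lc-heads-zero heads c))
          (cong (_∷ _) (trans (+-identityʳ (a * x)) (trans (cong (a *_) x≡0) (zeroʳ a))))

  linIndep⇒size≤dim : ∀ b {a} (es : Vec (V b) a) → LinIndepV p es → a ≤ b
  linIndep⇒size≤dim zero {zero} es li = z≤n
  linIndep⇒size≤dim zero {suc a} es li =
    ⊥-elim ([1]≢[0] p-prime (∷-injectiveˡ (li (1# ∷ replicate a 0#) (V₀-unique _))))
  linIndep⇒size≤dim (suc b) es li with cut-by-kernel ⊤-isSubspace head-isLinear es (AllV.universal _ es) li
    where
    ⊤-isSubspace : IsSubspace {suc b} (λ _ → ⊤)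
    ⊤-isSubspace = record { 0∈ = tt ; +∈ = λ _ _ → tt ; ·∈ = λ _ _ → tt }
    head-isLinear : IsLinear {suc b} head
    head-isLinear = record { +-hom = λ { (_ ∷ _) (_ ∷ _) → refl } ; ·-hom = λ { _ (_ ∷ _) → refl } }
  ... | independent es′ heads li′ , a≤1+a′ , _ =
    ℕₚ.≤-trans a≤1+a′ (s≤s (linIndep⇒size≤dim b (map tail es′) tails-linIndep))
    where
    tails-linIndep : LinIndepV p (map tail es′)
    tails-linIndep c eq = li′ c (trans (lc-heads-zero (AllV.map proj₂ heads) c) (cong (0# ∷_) eq))

  coordinates : ∀ {k a b} {w : Vec (V k) b} {u : Vec (V k) a} → AllV (_∈⟨ w ⟩) u →
                Σ (Vec (V b) a) λ es → u ≡ map (λ e → lc p e w) es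
  coordinates [] = [] , refl
  coordinates ((e , refl) ∷ u∈⟨w⟩) with coordinates u∈⟨w⟩
  ... | es , refl = e ∷ es , refl

  steinitz : ∀ {k a b} (w : Vec (V k) b) {u : Vec (V k) a} → LinIndepV p u → AllV (_∈⟨ w ⟩) u → a ≤ b
  steinitz {b = b} w li u∈⟨w⟩ with coordinates u∈⟨w⟩
  ... | es , refl = linIndep⇒size≤dim b es coordinates-linIndep
    where
    coordinates-linIndep : LinIndepV p es
    coordinates-linIndep c eq = li c (begin
      lc p c (map (λ e → lc p e w) es)  ≡⟨ lc-lc c es w ⟩
      lc p (lc p c es) w                ≡⟨ cong (λ e → lc p e w) eq ⟩
      lc p 0ᵛ w                         ≡⟨ lc-zeroˡ w ⟩
      0ᵛ                                ∎)
      where open ≡-Reasoning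

  attrSet-length-mono : ∀ {k} {Δ Γ : List (V k)} → AttrSet p Δ → (∀ {x} → x ∈ Δ → x ∈ Γ) → length Δ ≤ length Γ
  attrSet-length-mono {Γ = Γ} Δ-indep Δ⊆Γ =
    steinitz (fromList Γ) Δ-indep (fromList⁺ (All.tabulate λ x∈Δ → ∈⇒∈⟨⟩ (∈-fromList⁺ (Δ⊆Γ x∈Δ))))

  -- Defs states that a basis lies in W through a predicate local to HasDim; recover it from the Σ-type.
  private
    Family : {A : Set} {B : A → Set} (X : Set) → X ≡ Σ A B → A → Set
    Family {B = B} _ _ = B
    Domain : {A : Set} {B : A → Set} (X : Set) → X ≡ Σ A B → Set
    Domain {A = A} _ _ = A

  BasisIn : ∀ {k} (W : V k → Set) {d} → Vec (V k) d → Set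
  BasisIn W {d} bs = Domain (Family (HasDim p W d) refl bs) refl

  BasisIn⇒AllV : ∀ {k} {W : V k → Set} {d} (bs : Vec (V k) d) → BasisIn W bs → AllV W bs
  BasisIn⇒AllV [] _ = []
  BasisIn⇒AllV (b ∷ bs) (Wb , Wbs) = Wb ∷ BasisIn⇒AllV bs Wbs

  basis : ∀ {k} {W : V k → Set} {d} → HasDim p W d → Independent W
  basis (bs , W∋bs , li , _) = independent bs (BasisIn⇒AllV bs W∋bs) li

  basis-spans : ∀ {k} {W : V k → Set} {d} (h : HasDim p W d) → ∀ {v} → W v → v ∈⟨ vectors (basis h) ⟩
  basis-spans (bs , _ , _ , spans) {v} Wv = InSpanP-least (∈⟨⟩-isSubspace bs) ∈⇒∈⟨⟩ (spans v Wv)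

length-filter+length-filter-∁ : ∀ {A : Set} {P : A → Set} (P? : Decidable P) xs →
                                length (filter P? xs) ℕ.+ length (filter (∁? P?) xs) ≡ length xs
length-filter+length-filter-∁ P? [] = refl
length-filter+length-filter-∁ P? (x ∷ xs) with P? x
... | yes _ = cong suc (length-filter+length-filter-∁ P? xs)
... | no _ = trans (ℕₚ.+-suc _ _) (cong suc (length-filter+length-filter-∁ P? xs))

module SkewKernels (p : ℕ) .{{_ : NonZero p}} (p-prime : Prime p) where

  open Vectors p
  open Dimension p p-prime
  open Independent

  module _ {n} (ℬ : SkewSpace p n) where

    open Data.List.Membership.DecPropositional (≡-dec {n = n} (_≟_ {p})) using (_∈?_)

    KerSkewGen-isSubspace : ∀ Δ → IsSubspace (KerSkewGen p ℬ Δ)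
    KerSkewGen-isSubspace Δ = ∩-isSubspace
      (Π-isSubspace λ x → Π-isSubspace λ _ → kernel-isSubspace (dot-isLinear x))
      (Π-isSubspace λ B → Π-isSubspace λ _ → ⋆-preimage-isSubspace B (InSpanP-isSubspace (_∈ Δ)))

    KerSkew⊆KerSkewGen : ∀ {Δ v} → KerSkew p ℬ Δ v → KerSkewGen p ℬ Δ v
    KerSkew⊆KerSkewGen {Δ} = InSpanP-least (KerSkewGen-isSubspace Δ) (λ gen → gen)

    KerSkewGen-extend : ∀ {Δ Δ′} → _⊆_ p Δ Δ′ → ∀ {v} → KerSkewGen p ℬ Δ v →
                        All (λ x → dot p x v ≡ 0#) (filter (∁? (_∈? Δ)) Δ′) → KerSkewGen p ℬ Δ′ v
    KerSkewGen-extend {Δ} {Δ′} Δ⊆Δ′ {v} (⊥Δ , ℬv⊆⟨Δ⟩) ⊥Δ′∖Δ =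
      ⊥Δ′ , λ B B∈ℬ → InSpanP-mono (All.lookup Δ⊆Δ′) (ℬv⊆⟨Δ⟩ B B∈ℬ)
      where
      ⊥Δ′ : ∀ x → x ∈ Δ′ → dot p x v ≡ 0#
      ⊥Δ′ x x∈Δ′ with x ∈? Δ
      ... | yes x∈Δ = ⊥Δ x x∈Δ
      ... | no x∉Δ = All.lookup ⊥Δ′∖Δ (∈-filter⁺ (∁? (_∈? Δ)) x∈Δ′ x∉Δ)

    dim-KerSkew-mono : ∀ {Δ Δ′} → AttrSet p Δ → _⊆_ p Δ Δ′ → ∀ {d d′} →
                       HasDim p (KerSkew p ℬ Δ) d → HasDim p (KerSkew p ℬ Δ′) d′ → d ℕ.+ length Δ ≤ d′ ℕ.+ length Δ′
    dim-KerSkew-mono {Δ} {Δ′} Δ-indep Δ⊆Δ′ {d} {d′} h h′ = begin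
      d ℕ.+ length Δ                              ≤⟨ ℕₚ.+-mono-≤ d≤|K|+|Δ′∖Δ| |Δ|≤|Δ′∩Δ| ⟩
      size K ℕ.+ length Δ′∖Δ ℕ.+ length Δ′∩Δ      ≤⟨ ℕₚ.+-monoˡ-≤ _ (ℕₚ.+-monoˡ-≤ _ |K|≤d′) ⟩
      d′ ℕ.+ length Δ′∖Δ ℕ.+ length Δ′∩Δ          ≡⟨ ℕₚ.+-assoc d′ _ _ ⟩
      d′ ℕ.+ (length Δ′∖Δ ℕ.+ length Δ′∩Δ)        ≡⟨ cong (d′ ℕ.+_) (ℕₚ.+-comm (length Δ′∖Δ) _) ⟩
      d′ ℕ.+ (length Δ′∩Δ ℕ.+ length Δ′∖Δ)        ≡⟨ cong (d′ ℕ.+_) (length-filter+length-filter-∁ (_∈? Δ) Δ′) ⟩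
      d′ ℕ.+ length Δ′                            ∎
      where
      open ℕₚ.≤-Reasoning
      Δ′∩Δ Δ′∖Δ : List (V n)
      Δ′∩Δ = filter (_∈? Δ) Δ′
      Δ′∖Δ = filter (∁? (_∈? Δ)) Δ′
      cut = cut-by-kernels (KerSkewGen-isSubspace Δ) dot-isLinear Δ′∖Δ (Independent-map KerSkew⊆KerSkewGen (basis h))
      K = proj₁ cut
      d≤|K|+|Δ′∖Δ| : d ≤ size K ℕ.+ length Δ′∖Δ
      d≤|K|+|Δ′∖Δ| = proj₂ cut
      |K|≤d′ : size K ≤ d′
      |K|≤d′ = steinitz (vectors (basis h′)) (linIndep K)
        (AllV.map (λ (gen , ⊥Δ′∖Δ) → basis-spans h′ (InSpanP-∈ (KerSkewGen-extend Δ⊆Δ′ gen ⊥Δ′∖Δ))) (members K))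
      |Δ|≤|Δ′∩Δ| : length Δ ≤ length Δ′∩Δ
      |Δ|≤|Δ′∩Δ| = attrSet-length-mono Δ-indep λ x∈Δ → ∈-filter⁺ (_∈? Δ) (All.lookup Δ⊆Δ′ x∈Δ) x∈Δ

open import Data.Nat using (_+_)

lemma4p7 : (p : ℕ) .{{_ : NonZero p}} → Prime p → 2 < p →
    ((m n : ℕ) (𝒜 : MatSpace p m n) (Λ Λ′ : List (Vect p n)) →
       AttrSet p Λ → AttrSet p Λ′ → _⊆_ p Λ Λ′ →
       ∀ v → Ker p 𝒜 Λ v → Ker p 𝒜 Λ′ v)
    ×
    ((n : ℕ) (ℬ : SkewSpace p n) (Δ Δ′ : List (Vect p n)) →
       AttrSet p Δ → AttrSet p Δ′ → _⊆_ p Δ Δ′ →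
       ∀ d d′ → HasDim p (KerSkew p ℬ Δ) d → HasDim p (KerSkew p ℬ Δ′) d′ →
       d + length Δ ≤ d′ + length Δ′)
lemma4p7 p p-prime _ =
  (λ m n 𝒜 Λ Λ′ _ _ Λ⊆Λ′ v → Vectors.Ker-mono p 𝒜 Λ⊆Λ′) ,
  (λ n ℬ Δ Δ′ Δ-indep _ Δ⊆Δ′ d d′ → SkewKernels.dim-KerSkew-mono p p-prime ℬ Δ-indep Δ⊆Δ′)
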